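{- Let $(\mathcal{C},\otimes,I)$ be a symmetric monoidal category, $J$ an object, and $\perp$ an orthogonality on $\mathcal{C}$ relative to $J$. Then $\perp$ is reciprocal if and only if it is focused.
   Context: An orthogonality is a family of relations $\perp_R\subseteq\mathcal{C}(I,R)\times\mathcal{C}(R,J)$ ($R$ ranging over objects) satisfying: (isomorphism) for isomorphisms $f:R\to S$, $u\perp_Rx$ iff $f\circ u\perp_S x\circ f^{ -1}$; (tensor) for $u:I\to R$, $v:I\to S$, $h:R\otimes S\to J$, if $u\perp_R h\circ(R\otimes v)\circ\rho_R^{ -1}$ and $v\perp_S h\circ(u\otimes S)\circ\lambda_S^{ -1}$ then $u\otimes v\perp_{R\otimes S}h$, where $u\otimes v$ is $I\cong I\otimes I\to R\otimes S$; (identity) $u\perp_Rx$ implies $\mathrm{id}_I\perp_I x\circ u$. It is reciprocal if for all $u:I\to R$, $f:R\to S$, $x:S\to J$: $u\perp_R x\circ f$ iff $f\circ u\perp_S x$. It is focused if there is a subset $F\subseteq\mathcal{C}(I,J)$ such that for all $R$, $u:I\to R$, $x:R\to J$: $u\perp_Rx$ iff $x\circ u\in F$. -}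

module Defs where

open import Level using (Level; _⊔_; suc)
open import Data.Product using (Σ; _×_; _,_)
open import Relation.Binary.PropositionalEquality using (_≡_)

_⇔_ : ∀ {a b} → Set a → Set b → Set (a ⊔ b)
A ⇔ B = (A → B) × (B → A)

record Category (o ℓ : Level) : Set (suc (o ⊔ ℓ)) where
  infixr 9 _∘_
  field
    Obj : Set o
    Hom : Obj → Obj → Set ℓ
    id  : ∀ {A} → Hom A A
    _∘_ : ∀ {A B C} → Hom B C → Hom A B → Hom A C
    assoc     : ∀ {A B C D} {f : Hom A B} {g : Hom B C} {h : Hom C D} →
                (h ∘ g) ∘ f ≡ h ∘ (g ∘ f)
    identityˡ : ∀ {A B} {f : Hom A B} → id ∘ f ≡ f
    identityʳ : ∀ {A B} {f : Hom A B} → f ∘ id ≡ f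

  record IsIso {A B : Obj} (f : Hom A B) : Set ℓ where
    field
      inv  : Hom B A
      isoˡ : inv ∘ f ≡ id
      isoʳ : f ∘ inv ≡ id

record Monoidal {o ℓ} (C : Category o ℓ) : Set (o ⊔ ℓ) where
  open Category C
  infixr 10 _⊗₀_
  field
    _⊗₀_ : Obj → Obj → Obj
    ⊗₁   : ∀ {A B C D} → Hom A B → Hom C D → Hom (A ⊗₀ C) (B ⊗₀ D)
    unit : Obj
    ⊗-identity : ∀ {A B} → ⊗₁ (id {A}) (id {B}) ≡ id
    ⊗-homomorphism : ∀ {A B C D E F} {f : Hom A B} {g : Hom B C} {h : Hom D E} {k : Hom E F} →
                     ⊗₁ (g ∘ f) (k ∘ h) ≡ ⊗₁ g k ∘ ⊗₁ f h
    α⇒ : ∀ {X Y Z} → Hom ((X ⊗₀ Y) ⊗₀ Z) (X ⊗₀ (Y ⊗₀ Z))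
    α⇐ : ∀ {X Y Z} → Hom (X ⊗₀ (Y ⊗₀ Z)) ((X ⊗₀ Y) ⊗₀ Z)
    α-isoˡ : ∀ {X Y Z} → α⇐ {X} {Y} {Z} ∘ α⇒ ≡ id
    α-isoʳ : ∀ {X Y Z} → α⇒ {X} {Y} {Z} ∘ α⇐ ≡ id
    α-natural : ∀ {X X' Y Y' Z Z'} {f : Hom X X'} {g : Hom Y Y'} {h : Hom Z Z'} →
                α⇒ ∘ ⊗₁ (⊗₁ f g) h ≡ ⊗₁ f (⊗₁ g h) ∘ α⇒
    λ⇒ : ∀ {X} → Hom (unit ⊗₀ X) X
    λ⇐ : ∀ {X} → Hom X (unit ⊗₀ X)
    λ-isoˡ : ∀ {X} → λ⇐ {X} ∘ λ⇒ ≡ id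
    λ-isoʳ : ∀ {X} → λ⇒ {X} ∘ λ⇐ ≡ id
    λ-natural : ∀ {X Y} {f : Hom X Y} → λ⇒ ∘ ⊗₁ id f ≡ f ∘ λ⇒
    ρ⇒ : ∀ {X} → Hom (X ⊗₀ unit) X
    ρ⇐ : ∀ {X} → Hom X (X ⊗₀ unit)
    ρ-isoˡ : ∀ {X} → ρ⇐ {X} ∘ ρ⇒ ≡ id
    ρ-isoʳ : ∀ {X} → ρ⇒ {X} ∘ ρ⇐ ≡ id
    ρ-natural : ∀ {X Y} {f : Hom X Y} → ρ⇒ ∘ ⊗₁ f id ≡ f ∘ ρ⇒
    triangle : ∀ {X Y} → ⊗₁ (id {X}) (λ⇒ {Y}) ∘ α⇒ ≡ ⊗₁ ρ⇒ id
    pentagon : ∀ {W X Y Z} →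
               ⊗₁ (id {W}) (α⇒ {X} {Y} {Z}) ∘ α⇒ ∘ ⊗₁ α⇒ id ≡ α⇒ ∘ α⇒

record Symmetric {o ℓ} {C : Category o ℓ} (M : Monoidal C) : Set (o ⊔ ℓ) where
  open Category C
  open Monoidal M
  field
    σ : ∀ {X Y} → Hom (X ⊗₀ Y) (Y ⊗₀ X)
    σ-natural : ∀ {X X' Y Y'} {f : Hom X X'} {g : Hom Y Y'} →
                σ ∘ ⊗₁ f g ≡ ⊗₁ g f ∘ σ
    σ-involutive : ∀ {X Y} → σ {Y} {X} ∘ σ {X} {Y} ≡ id
    hexagon : ∀ {X Y Z} →
              α⇒ {Y} {Z} {X} ∘ σ ∘ α⇒ ≡ ⊗₁ id σ ∘ α⇒ ∘ ⊗₁ σ (id {Z})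

record Orthogonality {o ℓ} {C : Category o ℓ} (M : Monoidal C)
                     (J : Category.Obj C) (p : Level) : Set (o ⊔ ℓ ⊔ suc p) where
  open Category C
  open Monoidal M
  _⊗ᵖ_ : ∀ {R S} → Hom unit R → Hom unit S → Hom unit (R ⊗₀ S)
  u ⊗ᵖ v = ⊗₁ u v ∘ λ⇐
  field
    ⊥ : (R : Obj) → Hom unit R → Hom R J → Set p
    ⊥-iso : ∀ {R S} (f : Hom R S) (i : IsIso f) (u : Hom unit R) (x : Hom R J) →
            ⊥ R u x ⇔ ⊥ S (f ∘ u) (x ∘ IsIso.inv i)
    ⊥-tensor : ∀ {R S} (u : Hom unit R) (v : Hom unit S) (h : Hom (R ⊗₀ S) J) →
               ⊥ R u (h ∘ ⊗₁ id v ∘ ρ⇐) →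
               ⊥ S v (h ∘ ⊗₁ u id ∘ λ⇐) →
               ⊥ (R ⊗₀ S) (u ⊗ᵖ v) h
    ⊥-identity : ∀ {R} (u : Hom unit R) (x : Hom R J) →
                 ⊥ R u x → ⊥ unit id (x ∘ u)

module _ {o ℓ} {C : Category o ℓ} {M : Monoidal C} {J : Category.Obj C} {p : Level} where
  open Category C
  open Monoidal M
  open Orthogonality

  Reciprocal : Orthogonality M J p → Set (o ⊔ ℓ ⊔ p)
  Reciprocal O = ∀ {R S} (u : Hom unit R) (f : Hom R S) (x : Hom S J) →
                 ⊥ O R u (x ∘ f) ⇔ ⊥ O S (f ∘ u) x

  Focused : Orthogonality M J p → Set (o ⊔ ℓ ⊔ suc p)
  Focused O = Σ (Hom unit J → Set p) λ F →
              ∀ {R} (u : Hom unit R) (x : Hom R J) → ⊥ O R u x ⇔ F (x ∘ u)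

module Submission where

open import Defs
open import Data.Product using (_,_)
open import Relation.Binary.PropositionalEquality using (subst; sym)

-- None of the orthogonality axioms is needed: taking u = id in reciprocity
-- shows u ⊥ x iff id ⊥ x ∘ u, so F := { y | id ⊥ y } witnesses focusing;
-- conversely x ∘ (f ∘ u) = (x ∘ f) ∘ u makes any focused relation reciprocal.

module _ {o ℓ p} {C : Category o ℓ} {M : Monoidal C} {J : Category.Obj C}
         (O : Orthogonality M J p) where
  open Category C
  open Monoidal M using (unit)
  open Orthogonality O

  reciprocal⇒focused : Reciprocal O → Focused O
  reciprocal⇒focused rec = (λ y → ⊥ unit id y) , λ {R} u x →
    let (id⊥xu⇒u⊥x , u⊥x⇒id⊥xu) = rec id u x in
      (λ u⊥x → u⊥x⇒id⊥xu (subst (λ v → ⊥ R v x) (sym identityʳ) u⊥x))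
    , (λ id⊥xu → subst (λ v → ⊥ R v x) identityʳ (id⊥xu⇒u⊥x id⊥xu))

  focused⇒reciprocal : Focused O → Reciprocal O
  focused⇒reciprocal (F , ⊥⇔F) u f x =
    let (u⊥xf⇒F , F⇒u⊥xf) = ⊥⇔F u (x ∘ f)
        (fu⊥x⇒F , F⇒fu⊥x) = ⊥⇔F (f ∘ u) x in
      (λ u⊥xf → F⇒fu⊥x (subst F assoc (u⊥xf⇒F u⊥xf)))
    , (λ fu⊥x → F⇒u⊥xf (subst F (sym assoc) (fu⊥x⇒F fu⊥x)))

mainTheorem9 : ∀ {o ℓ p} {C : Category o ℓ} (M : Monoidal C) (S : Symmetric M)
    (J : Category.Obj C) (O : Orthogonality M J p) →
    Reciprocal O ⇔ Focused O
mainTheorem9 M S J O = reciprocal⇒focused O , focused⇒reciprocal O
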